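{- For every graph $H$ we have $\operatorname{box}_\ell(H) = \overline{\operatorname{box}}_\ell(H) = \overline{\operatorname{box}}_f(H)$.
   Context: All graphs are finite and simple; $H^c$ denotes the complement of $H$. An interval graph is an intersection graph of intervals on the real line; a co-interval graph is the complement of an interval graph. $\mathcal{C}$ is the class of all co-interval graphs and $\overline{\mathcal{C}}$ is the class of all graphs that are vertex-disjoint unions of co-interval graphs. A graph homomorphism $\varphi: G\to H$ is a map $V(G)\to V(H)$ with $uv\in E(G)\Rightarrow \varphi(u)\varphi(v)\in E(H)$. For a graph class $\mathcal{G}$, a graph $H$ and a positive integer $t$, a $t$-global $\mathcal{G}$-cover of $H$ is an edge-surjective homomorphism $\varphi: G_1\sqcup\cdots\sqcup G_t\to H$ (vertex-disjoint union) with each $G_i\in\mathcal{G}$; it is injective if its restriction to each $G_i$ is injective, and $s$-local if $|\varphi^{ -1}(v)|\le s$ for all $v\in V(H)$. The local covering number $c_\ell^{\mathcal{G}}(H)$ is the minimum $s$ such that an $s$-local injective $\mathcal{G}$-cover of $H$ exists (with any number $t$ of graphs); the folded covering number $c_f^{\mathcal{G}}(H)$ is the minimum $s$ such that a $1$-global $s$-local $\mathcal{G}$-cover of $H$ exists (minimum of the empty set is $\infty$). Define $\operatorname{box}_\ell(H):=c_\ell^{\mathcal{C}}(H^c)$, $\overline{\operatorname{box}}_\ell(H):=c_\ell^{\overline{\mathcal{C}}}(H^c)$, $\overline{\operatorname{box}}_f(H):=c_f^{\overline{\mathcal{C}}}(H^c)$. -}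

module Defs where

open import Level using (Lift)
open import Data.Nat using (ℕ; _≤_)
open import Data.Fin using (Fin)
open import Data.Fin.Properties using (_≟_)
open import Data.List using (List; length; filter; map; allFin)
open import Data.Nat.ListAction using (sum)
open import Data.Product using (Σ; ∃; ∃₂; _×_; _,_)
open import Data.Rational as ℚ using (ℚ)
open import Relation.Nullary using (¬_; Dec; yes; no)
open import Relation.Nullary.Decidable using (_×-dec_; ¬?)
open import Relation.Binary.PropositionalEquality using (_≡_; _≢_; refl; sym)
open import Function.Bundles using (_⇔_; _↔_; Inverse)
open import Function.Definitions using (Injective)

record Graph : Set₁ where
  field
    n     : ℕ
    E     : Fin n → Fin n → Set
    E-dec : ∀ u v → Dec (E u v)
    E-sym : ∀ {u v} → E u v → E v u
    E-irr : ∀ {v} → ¬ E v v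

open Graph public

_ᶜ : Graph → Graph
G ᶜ = record
  { n     = n G
  ; E     = λ u v → (u ≢ v) × ¬ E G u v
  ; E-dec = λ u v → ¬? (u ≟ v) ×-dec ¬? (E-dec G u v)
  ; E-sym = λ { (u≢v , ¬e) → (λ p → u≢v (sym p)) , (λ e → ¬e (E-sym G e)) }
  ; E-irr = λ { (v≢v , _) → v≢v refl }
  }

record Interval : Set where
  field
    lo hi : ℚ
    lo≤hi : lo ℚ.≤ hi

open Interval public

Meets : Interval → Interval → Set
Meets I J = ∃ λ (x : ℚ) → (lo I ℚ.≤ x × x ℚ.≤ hi I) × (lo J ℚ.≤ x × x ℚ.≤ hi J)

IsInterval : Graph → Set
IsInterval G = Σ (Fin (n G) → Interval) λ I →
  ∀ u v → u ≢ v → (E G u v ⇔ Meets (I u) (I v))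

IsCoInterval : Graph → Set
IsCoInterval G = IsInterval (G ᶜ)

Class : Set₂
Class = Graph → Set₁

𝒞 : Class
𝒞 G = Lift _ (IsCoInterval G)

UV : ∀ {t} → (Fin t → Graph) → Set
UV {t} Gs = Σ (Fin t) λ i → Fin (n (Gs i))

data UE {t} (Gs : Fin t → Graph) : UV Gs → UV Gs → Set where
  edge : ∀ {i u v} → E (Gs i) u v → UE Gs (i , u) (i , v)

IsUnionOf : Graph → ∀ {t} → (Fin t → Graph) → Set
IsUnionOf G Gs = Σ (Fin (n G) ↔ UV Gs) λ f →
  ∀ u v → (E G u v ⇔ UE Gs (Inverse.to f u) (Inverse.to f v))

𝒞‾ : Class
𝒞‾ G = ∃ λ (t : ℕ) → Σ (Fin t → Graph) λ Gs →
  (∀ i → IsCoInterval (Gs i)) × IsUnionOf G Gs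

-- Covers.  A homomorphism from G₁ ⊔ ⋯ ⊔ G_t to H is given by its
-- restrictions φ i : G_i → H.

record Cover (𝒢 : Class) (H : Graph) (t : ℕ) : Set₁ where
  field
    G       : Fin t → Graph
    inClass : ∀ i → 𝒢 (G i)
    φ       : ∀ i → Fin (n (G i)) → Fin (n H)
    hom     : ∀ i {u v} → E (G i) u v → E H (φ i u) (φ i v)
    surj    : ∀ {x y} → E H x y →
              ∃ λ i → ∃₂ λ u v → E (G i) u v × φ i u ≡ x × φ i v ≡ y

  preimageSize : Fin (n H) → ℕ
  preimageSize x =
    sum (map (λ i → length (filter (λ u → φ i u ≟ x) (allFin (n (G i)))))
             (allFin t))

  IsInjective : Set
  IsInjective = ∀ i → Injective _≡_ _≡_ (φ i)

  IsLocal : ℕ → Set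
  IsLocal s = ∀ x → preimageSize x ≤ s

open Cover public

LocalCoverable : Class → Graph → ℕ → Set₁
LocalCoverable 𝒢 H s =
  ∃ λ (t : ℕ) → Σ (Cover 𝒢 H t) λ c → IsInjective c × IsLocal c s

FoldedCoverable : Class → Graph → ℕ → Set₁
FoldedCoverable 𝒢 H s = Σ (Cover 𝒢 H 1) λ c → IsLocal c s

-- ℕ ∪ {∞} and minima (min ∅ = ∞)

data ℕ∞ : Set where
  fin : ℕ → ℕ∞
  ∞   : ℕ∞

IsMinimum : (ℕ → Set₁) → ℕ∞ → Set₁
IsMinimum P (fin m) = P m × (∀ k → P k → m ≤ k)
IsMinimum P ∞       = ∀ k → ¬ P k

c-ℓ : Class → Graph → ℕ∞ → Set₁
c-ℓ 𝒢 H = IsMinimum (LocalCoverable 𝒢 H)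

c-f : Class → Graph → ℕ∞ → Set₁
c-f 𝒢 H = IsMinimum (FoldedCoverable 𝒢 H)

box-ℓ : Graph → ℕ∞ → Set₁
box-ℓ H = c-ℓ 𝒞 (H ᶜ)

box‾-ℓ : Graph → ℕ∞ → Set₁
box‾-ℓ H = c-ℓ 𝒞‾ (H ᶜ)

box‾-f : Graph → ℕ∞ → Set₁
box‾-f H = c-f 𝒞‾ (H ᶜ)

module Submission where

-- All three numbers are minima over s of a coverability property of K = Hᶜ, so it suffices
-- to show that the three properties are equivalent for each s:
--   * a 𝒞-cover is a 𝒞‾-cover (each co-interval graph is a one-summand union);
--   * merging: the disjoint union of all components of a 𝒞-cover is one 𝒞‾-graph, which
--     gives a 1-global 𝒞‾-cover with the same loads;
--   * splitting: the summands of the components of a 𝒞‾-cover form a 𝒞-cover with the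
--     same loads;
--   * shrinking: in a 𝒞-cover, the vertices of one component with a common image form an
--     independent set, so their intervals pairwise meet; replacing each such fiber by the
--     common part of its intervals gives an injective 𝒞-cover with no larger loads.

open import Defs
open import Level using (lift; lower)
open import Data.Nat using (ℕ; zero; suc; _+_; _≤_; z≤n; s≤s)
import Data.Nat.Properties as ℕP
import Data.Nat.ListAction as ListAction
open import Data.Fin using (Fin; zero; suc; _↑ˡ_; _↑ʳ_; splitAt)
open import Data.Fin.Properties using (_≟_; any?; suc-injective; 0≢1+n; splitAt-↑ˡ; splitAt-↑ʳ; join-splitAt)
open import Data.List using (List; length; filter; map; allFin; tabulate)
import Data.List.Relation.Unary.All as All
open import Data.List.Relation.Unary.All.Properties using (all-filter)
open import Data.List.Membership.Propositional using (_∈_)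
open import Data.List.Membership.Propositional.Properties using (∈-filter⁺; ∈-allFin)
open import Data.Product using (Σ; ∃; ∃₂; _×_; _,_; proj₁; proj₂)
open import Data.Sum using (_⊎_; inj₁; inj₂; [_,_]′; swap)
open import Data.Rational as ℚ using (_⊔_)
import Data.Rational.Properties as ℚP
open import Relation.Binary.Bundles using (DecTotalOrder)
open import Data.List.Extrema (DecTotalOrder.totalOrder ℚP.≤-decTotalOrder)
  using (argmax; argmin; argmax-all; argmin-all; f[xs]≤f[argmax]; f[argmin]≤f[xs])
open import Data.Empty using (⊥-elim)
open import Relation.Nullary using (¬_; Dec; yes; no)
open import Relation.Nullary.Decidable using (_⊎-dec_; map′; decidable-stable)
open import Relation.Unary using (Decidable)
open import Relation.Binary.PropositionalEquality hiding (J)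
open import Function using (_∘_; id)
open import Function.Bundles using (_⇔_; _↔_; Inverse; Equivalence; mk↔ₛ′; mk⇔)
open import Function.Properties.Inverse using (↔-trans; ↔-sym)
import Function.Properties.Equivalence as ⇔
open import Function.Definitions using (Injective)
open import Algebra.Properties.CommutativeMonoid.Sum ℕP.+-0-commutativeMonoid
  using (sum; sum-syntax; sum-cong-≗; ∑-permute)

∑-↑ : ∀ m {n} (h : Fin (m + n) → ℕ) →
      sum h ≡ sum (h ∘ (_↑ˡ n)) + sum (h ∘ (m ↑ʳ_))
∑-↑ zero    h = refl
∑-↑ (suc m) h = trans (cong (h zero +_) (∑-↑ m (h ∘ suc))) (sym (ℕP.+-assoc (h zero) _ _))

∑-mono-≤ : ∀ {t} {f g : Fin t → ℕ} → (∀ i → f i ≤ g i) → sum f ≤ sum g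
∑-mono-≤ {zero}  f≤g = z≤n
∑-mono-≤ {suc t} f≤g = ℕP.+-mono-≤ (f≤g zero) (∑-mono-≤ (f≤g ∘ suc))

Σᶠ : ∀ {t} → (Fin t → ℕ) → Set
Σᶠ {t} sz = Σ (Fin t) (Fin ∘ sz)

module _ {t} {sz : Fin (suc t) → ℕ} where
  shift : Σᶠ (sz ∘ suc) → Σᶠ sz
  shift (i , a) = suc i , a

enum : ∀ {t} (sz : Fin t → ℕ) → Fin (sum sz) → Σᶠ sz
enum {zero}  sz ()
enum {suc t} sz k = [ (zero ,_) , shift ∘ enum (sz ∘ suc) ]′ (splitAt (sz zero) k)

unenum : ∀ {t} (sz : Fin t → ℕ) → Σᶠ sz → Fin (sum sz)
unenum sz (zero  , a) = a ↑ˡ _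
unenum sz (suc i , a) = sz zero ↑ʳ unenum (sz ∘ suc) (i , a)

enum-↑ˡ : ∀ {t} (sz : Fin (suc t) → ℕ) a → enum sz (a ↑ˡ sum (sz ∘ suc)) ≡ (zero , a)
enum-↑ˡ sz a rewrite splitAt-↑ˡ (sz zero) a (sum (sz ∘ suc)) = refl

enum-↑ʳ : ∀ {t} (sz : Fin (suc t) → ℕ) b → enum sz (sz zero ↑ʳ b) ≡ shift (enum (sz ∘ suc) b)
enum-↑ʳ sz b rewrite splitAt-↑ʳ (sz zero) (sum (sz ∘ suc)) b = refl

enum-unenum : ∀ {t} (sz : Fin t → ℕ) p → enum sz (unenum sz p) ≡ p
enum-unenum sz (zero  , a) = enum-↑ˡ sz a
enum-unenum sz (suc i , a) = trans (enum-↑ʳ sz _) (cong shift (enum-unenum (sz ∘ suc) (i , a)))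

unenum-enum : ∀ {t} (sz : Fin t → ℕ) k → unenum sz (enum sz k) ≡ k
unenum-enum {suc t} sz k with splitAt (sz zero) k | join-splitAt (sz zero) (sum (sz ∘ suc)) k
... | inj₁ a | a↑ˡ≡k = a↑ˡ≡k
... | inj₂ b | ↑ʳb≡k = trans (cong (sz zero ↑ʳ_) (unenum-enum (sz ∘ suc) b)) ↑ʳb≡k

enum-↔ : ∀ {t} (sz : Fin t → ℕ) → Fin (sum sz) ↔ Σᶠ sz
enum-↔ sz = mk↔ₛ′ (enum sz) (unenum sz) (enum-unenum sz) (unenum-enum sz)

∑-enum : ∀ {t} (sz : Fin t → ℕ) (g : Σᶠ sz → ℕ) →
         ∑[ k < sum sz ] g (enum sz k) ≡ ∑[ i < t ] ∑[ a < sz i ] g (i , a)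
∑-enum {zero}  sz g = refl
∑-enum {suc t} sz g = begin
  sum (g ∘ enum sz)
    ≡⟨ ∑-↑ (sz zero) (g ∘ enum sz) ⟩
  sum (g ∘ enum sz ∘ (_↑ˡ rest)) + sum (g ∘ enum sz ∘ (sz zero ↑ʳ_))
    ≡⟨ cong₂ _+_ (sum-cong-≗ (cong g ∘ enum-↑ˡ sz)) (sum-cong-≗ (cong g ∘ enum-↑ʳ sz)) ⟩
  sum (λ a → g (zero , a)) + sum (g ∘ shift ∘ enum (sz ∘ suc))
    ≡⟨ cong (sum (λ a → g (zero , a)) +_) (∑-enum (sz ∘ suc) (g ∘ shift)) ⟩
  ∑[ i < suc t ] ∑[ a < sz i ] g (i , a) ∎
  where
  open ≡-Reasoning
  rest : ℕ
  rest = sum (sz ∘ suc)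

⟦_⟧ : ∀ {p} {P : Set p} → Dec P → ℕ
⟦ yes _ ⟧ = 1
⟦ no  _ ⟧ = 0

fiber : ∀ {m k} → (Fin m → Fin k) → Fin k → ℕ
fiber {m} f x = ∑[ u < m ] ⟦ f u ≟ x ⟧

fiber-∉ : ∀ {m k} (f : Fin m → Fin k) {x} → (∀ u → f u ≢ x) → fiber f x ≡ 0
fiber-∉ {zero}  f     x∉ = refl
fiber-∉ {suc m} f {x} x∉ with f zero ≟ x
... | yes f0≡x = ⊥-elim (x∉ zero f0≡x)
... | no  _    = fiber-∉ (f ∘ suc) (x∉ ∘ suc)

fiber-∈ : ∀ {m k} (f : Fin m → Fin k) {x} u → f u ≡ x → 1 ≤ fiber f x
fiber-∈ f {x} zero fu≡x with f zero ≟ x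
... | yes _    = s≤s z≤n
... | no f0≢x  = ⊥-elim (f0≢x fu≡x)
fiber-∈ f {x} (suc u) fu≡x with f zero ≟ x
... | yes _ = s≤s z≤n
... | no  _ = fiber-∈ (f ∘ suc) u fu≡x

fiber-injective : ∀ {m k} (f : Fin m → Fin k) → Injective _≡_ _≡_ f → ∀ x → fiber f x ≤ 1
fiber-injective {zero}  f inj x = z≤n
fiber-injective {suc m} f inj x with f zero ≟ x
... | yes f0≡x = ℕP.≤-reflexive (cong suc (fiber-∉ (f ∘ suc)
                   (λ u fu≡x → 0≢1+n (inj (trans f0≡x (sym fu≡x))))))
... | no  _    = fiber-injective (f ∘ suc) (suc-injective ∘ inj) x

fiber-≤ : ∀ {l m k} (ψ : Fin m → Fin k) (φ : Fin l → Fin k) → Injective _≡_ _≡_ ψ →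
          (∀ y → ∃ λ u → φ u ≡ ψ y) → ∀ x → fiber ψ x ≤ fiber φ x
fiber-≤ ψ φ inj im⊆ x with any? (λ y → ψ y ≟ x)
... | yes (y , ψy≡x) = ℕP.≤-trans (fiber-injective ψ inj x)
                         (fiber-∈ φ (proj₁ (im⊆ y)) (trans (proj₂ (im⊆ y)) ψy≡x))
... | no  x∉         = subst (_≤ fiber φ x) (sym (fiber-∉ ψ (λ y ψy≡x → x∉ (y , ψy≡x)))) z≤n

load : ∀ {𝒢 K t} → Cover 𝒢 K t → Fin (n K) → ℕ
load {t = t} c x = ∑[ i < t ] fiber (φ c i) x

sum-map-tabulate : ∀ {A : Set} {m} (f : A → ℕ) (g : Fin m → A) →
                   ListAction.sum (map f (tabulate g)) ≡ sum (f ∘ g)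
sum-map-tabulate {m = zero}  f g = refl
sum-map-tabulate {m = suc m} f g = cong (f (g zero) +_) (sum-map-tabulate f (g ∘ suc))

length-filter-tabulate : ∀ {A : Set} {p} {P : A → Set p} (P? : Decidable P) {m} (g : Fin m → A) →
                         length (filter P? (tabulate g)) ≡ ∑[ i < m ] ⟦ P? (g i) ⟧
length-filter-tabulate P? {zero}  g = refl
length-filter-tabulate P? {suc m} g with P? (g zero)
... | yes _ = cong suc (length-filter-tabulate P? (g ∘ suc))
... | no  _ = length-filter-tabulate P? (g ∘ suc)

preimageSize≡load : ∀ {𝒢 K t} (c : Cover 𝒢 K t) x → preimageSize c x ≡ load c x
preimageSize≡load c x =
  trans (sum-map-tabulate (λ i → length (filter (λ u → φ c i u ≟ x) (allFin (n (G c i))))) id)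
        (sum-cong-≗ (λ i → length-filter-tabulate (λ u → φ c i u ≟ x) id))

local-≤ : ∀ {𝒢 𝒢′ K t t′} (c : Cover 𝒢 K t) (c′ : Cover 𝒢′ K t′) →
          (∀ x → load c x ≤ load c′ x) → ∀ {s} → IsLocal c′ s → IsLocal c s
local-≤ c c′ c≤c′ {s} c′-local x = begin
  preimageSize c x   ≡⟨ preimageSize≡load c x ⟩
  load c x           ≤⟨ c≤c′ x ⟩
  load c′ x          ≡⟨ preimageSize≡load c′ x ⟨
  preimageSize c′ x  ≤⟨ c′-local x ⟩
  s                  ∎
  where open ℕP.≤-Reasoning

UE-dec : ∀ {t} (Gs : Fin t → Graph) p q → Dec (UE Gs p q)
UE-dec Gs (i , u) (j , v) with i ≟ j
... | no  i≢j  = no λ { (edge _) → i≢j refl }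
... | yes refl with E-dec (Gs i) u v
...   | yes e  = yes (edge e)
...   | no  ¬e = no λ { (edge e) → ¬e e }

UE-sym : ∀ {t} {Gs : Fin t → Graph} {p q} → UE Gs p q → UE Gs q p
UE-sym {Gs = Gs} (edge {i} e) = edge (E-sym (Gs i) e)

UE-irr : ∀ {t} {Gs : Fin t → Graph} {p} → ¬ UE Gs p p
UE-irr {Gs = Gs} (edge {i} e) = E-irr (Gs i) e

⨆ : ∀ {t} → (Fin t → Graph) → Graph
⨆ Gs = record
  { n     = sum (n ∘ Gs)
  ; E     = λ a b → UE Gs (enum (n ∘ Gs) a) (enum (n ∘ Gs) b)
  ; E-dec = λ a b → UE-dec Gs (enum (n ∘ Gs) a) (enum (n ∘ Gs) b)
  ; E-sym = UE-sym
  ; E-irr = UE-irr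
  }

⨆-isUnion : ∀ {t} (Gs : Fin t → Graph) → IsUnionOf (⨆ Gs) Gs
⨆-isUnion Gs = enum-↔ (n ∘ Gs) , λ _ _ → mk⇔ id id

self-isUnion : (G₀ : Graph) → IsUnionOf G₀ {1} (λ _ → G₀)
self-isUnion G₀ =
  mk↔ₛ′ (zero ,_) proj₂ (λ { (zero , u) → refl }) (λ _ → refl) ,
  λ _ _ → mk⇔ edge (λ { (edge e) → e })

module UnionOf (G₀ : Graph) {t} (Gs : Fin t → Graph) (U : IsUnionOf G₀ Gs) where
  private
    f = proj₁ U
    edges = proj₂ U

  ι : ∀ j → Fin (n (Gs j)) → Fin (n G₀)
  ι j a = Inverse.from f (j , a)

  ι-hom : ∀ j {a b} → E (Gs j) a b → E G₀ (ι j a) (ι j b)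
  ι-hom j {a} {b} e = Equivalence.from (edges (ι j a) (ι j b))
    (subst₂ (UE Gs) (sym (Inverse.strictlyInverseˡ f (j , a)))
                    (sym (Inverse.strictlyInverseˡ f (j , b))) (edge e))

  ι-edge : ∀ {u v} → E G₀ u v → ∃ λ j → ∃₂ λ a b → E (Gs j) a b × ι j a ≡ u × ι j b ≡ v
  ι-edge {u} {v} e = lift-edge (Equivalence.to (edges u v) e)
    (Inverse.strictlyInverseʳ f u) (Inverse.strictlyInverseʳ f v)
    where
    lift-edge : ∀ {p q} → UE Gs p q → Inverse.from f p ≡ u → Inverse.from f q ≡ v →
                ∃ λ j → ∃₂ λ a b → E (Gs j) a b × ι j a ≡ u × ι j b ≡ v
    lift-edge (edge {j} {a} {b} e′) a↦u b↦v = j , a , b , e′ , a↦u , b↦v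

  ∑-ι : (w : Fin (n G₀) → ℕ) → sum w ≡ ∑[ j < t ] ∑[ a < n (Gs j) ] w (ι j a)
  ∑-ι w = trans (∑-permute w (↔-trans (enum-↔ (n ∘ Gs)) (↔-sym f)))
                (∑-enum (n ∘ Gs) (w ∘ Inverse.from f))

record _≺_ (I J : Interval) : Set where
  constructor precedes
  field gap : hi I ℚ.< lo J

open _≺_

Disjoint : Interval → Interval → Set
Disjoint I J = I ≺ J ⊎ J ≺ I

_≺?_ : ∀ I J → Dec (I ≺ J)
I ≺? J = map′ precedes gap (hi I ℚP.<? lo J)

disjoint? : ∀ I J → Dec (Disjoint I J)
disjoint? I J = (I ≺? J) ⊎-dec (J ≺? I)

Disjoint-irrefl : ∀ {I} → ¬ Disjoint I I
Disjoint-irrefl {I} d = ℚP.<-irrefl refl (ℚP.<-≤-trans (gap ([ id , id ]′ d)) (lo≤hi I))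

≺⇒¬Meets : ∀ {I J} → I ≺ J → ¬ Meets I J
≺⇒¬Meets I≺J (x , (_ , x≤hiI) , (loJ≤x , _)) =
  ℚP.<-irrefl refl (ℚP.≤-<-trans x≤hiI (ℚP.<-≤-trans (gap I≺J) loJ≤x))

Disjoint⇒¬Meets : ∀ {I J} → Disjoint I J → ¬ Meets I J
Disjoint⇒¬Meets (inj₁ I≺J) mt              = ≺⇒¬Meets I≺J mt
Disjoint⇒¬Meets (inj₂ J≺I) (x , x∈I , x∈J) = ≺⇒¬Meets J≺I (x , x∈J , x∈I)

-- Intervals that are not disjoint share the point  lo I ⊔ lo J.
¬Disjoint⇒Meets : ∀ {I J} → ¬ Disjoint I J → Meets I J
¬Disjoint⇒Meets {I} {J} ¬d =
  lo I ⊔ lo J ,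
  (ℚP.p≤p⊔q (lo I) (lo J) , ℚP.⊔-lub (lo≤hi I) (ℚP.≮⇒≥ (¬d ∘ inj₁ ∘ precedes))) ,
  (ℚP.p≤q⊔p (lo I) (lo J) , ℚP.⊔-lub (ℚP.≮⇒≥ (¬d ∘ inj₂ ∘ precedes)) (lo≤hi J))

¬Meets⇒Disjoint : ∀ {I J} → ¬ Meets I J → Disjoint I J
¬Meets⇒Disjoint {I} {J} ¬mt with disjoint? I J
... | yes d  = d
... | no  ¬d = ⊥-elim (¬mt (¬Disjoint⇒Meets ¬d))

record _⊑_ (I J : Interval) : Set where
  constructor within
  field
    lo-≥ : lo J ℚ.≤ lo I
    hi-≤ : hi I ℚ.≤ hi J

open _⊑_

≺-⊑ : ∀ {I I′ J J′} → I′ ⊑ I → J′ ⊑ J → I ≺ J → I′ ≺ J′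
≺-⊑ I′⊑I J′⊑J I≺J = precedes (ℚP.≤-<-trans (hi-≤ I′⊑I) (ℚP.<-≤-trans (gap I≺J) (lo-≥ J′⊑J)))

Disjoint-⊑ : ∀ {I I′ J J′} → I′ ⊑ I → J′ ⊑ J → Disjoint I J → Disjoint I′ J′
Disjoint-⊑ I′⊑I J′⊑J (inj₁ I≺J) = inj₁ (≺-⊑ I′⊑I J′⊑J I≺J)
Disjoint-⊑ I′⊑I J′⊑J (inj₂ J≺I) = inj₂ (≺-⊑ J′⊑J I′⊑I J≺I)

DisjointnessModel : (G₀ : Graph) → (Fin (n G₀) → Interval) → Set
DisjointnessModel G₀ I = ∀ u v → E G₀ u v ⇔ Disjoint (I u) (I v)

coInterval⇒model : ∀ G₀ → IsCoInterval G₀ → Σ (Fin (n G₀) → Interval) (DisjointnessModel G₀)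
coInterval⇒model G₀ (I , complement-rep) = I , model
  where
  model : DisjointnessModel G₀ I
  model u v with u ≟ v
  ... | yes refl = mk⇔ (⊥-elim ∘ E-irr G₀) (⊥-elim ∘ Disjoint-irrefl)
  ... | no  u≢v  = mk⇔
    (λ e → ¬Meets⇒Disjoint λ mt → proj₂ (Equivalence.from rep mt) e)
    (λ d → decidable-stable (E-dec G₀ u v) λ ¬e → Disjoint⇒¬Meets d (Equivalence.to rep (u≢v , ¬e)))
    where rep = complement-rep u v u≢v

disjointnessGraph : ∀ {m} → (Fin m → Interval) → Graph
disjointnessGraph {m} J = record
  { n     = m
  ; E     = λ a b → Disjoint (J a) (J b)
  ; E-dec = λ a b → disjoint? (J a) (J b)
  ; E-sym = swap
  ; E-irr = Disjoint-irrefl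
  }

disjointnessGraph-coInterval : ∀ {m} (J : Fin m → Interval) → IsCoInterval (disjointnessGraph J)
disjointnessGraph-coInterval J = J , λ a b a≢b →
  mk⇔ (¬Disjoint⇒Meets ∘ proj₂) (λ mt → a≢b , λ d → Disjoint⇒¬Meets d mt)

record Enumeration {k} (P : Fin k → Set) : Set where
  field
    size      : ℕ
    elem      : Fin size → Fin k
    injective : Injective _≡_ _≡_ elem
    sound     : ∀ y → P (elem y)
    complete  : ∀ {x} → P x → ∃ λ y → elem y ≡ x

enumerate : ∀ {k} {P : Fin k → Set} → Decidable P → Enumeration P
enumerate {zero} P? = record
  { size = 0 ; elem = λ () ; injective = λ { {()} } ; sound = λ () ; complete = λ { {()} } }
enumerate {suc k} P? with P? zero
... | yes P0 = record
  { size      = suc size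
  ; elem      = elem′
  ; injective = injective′
  ; sound     = λ { zero → P0 ; (suc y) → sound y }
  ; complete  = λ { {zero} _ → zero , refl
                  ; {suc x} Px → suc (proj₁ (complete Px)) , cong suc (proj₂ (complete Px)) }
  }
  where
  open Enumeration (enumerate (P? ∘ suc))
  elem′ : Fin (suc size) → Fin (suc k)
  elem′ zero    = zero
  elem′ (suc y) = suc (elem y)
  injective′ : Injective _≡_ _≡_ elem′
  injective′ {zero}  {zero}  _  = refl
  injective′ {suc a} {suc b} eq = cong suc (injective (suc-injective eq))
  injective′ {zero}  {suc _} ()
  injective′ {suc _} {zero}  ()
... | no ¬P0 = record
  { size      = size
  ; elem      = suc ∘ elem
  ; injective = injective ∘ suc-injective
  ; sound     = sound
  ; complete  = λ { {zero} P0 → ⊥-elim (¬P0 P0)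
                  ; {suc x} Px → proj₁ (complete Px) , cong suc (proj₂ (complete Px)) }
  }
  where open Enumeration (enumerate (P? ∘ suc))

𝒞⊆𝒞‾ : ∀ G₀ → 𝒞 G₀ → 𝒞‾ G₀
𝒞⊆𝒞‾ G₀ (lift co) = 1 , (λ _ → G₀) , (λ _ → co) , self-isUnion G₀

as𝒞‾ : ∀ {K t} → Cover 𝒞 K t → Cover 𝒞‾ K t
as𝒞‾ c = record { G = G c ; inClass = λ i → 𝒞⊆𝒞‾ (G c i) (inClass c i) ; φ = φ c ; hom = hom c ; surj = surj c }

module Merge {K t} (c : Cover 𝒞 K t) where
  sizes : Fin t → ℕ
  sizes = n ∘ G c

  open UnionOf (⨆ (G c)) (G c) (⨆-isUnion (G c))

  φ⊔ : Σᶠ sizes → Fin (n K)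
  φ⊔ (i , u) = φ c i u

  φ⊔-hom : ∀ {p q} → UE (G c) p q → E K (φ⊔ p) (φ⊔ q)
  φ⊔-hom (edge {i} e) = hom c i e

  φ⊔-ι : ∀ i u → φ⊔ (enum sizes (ι i u)) ≡ φ c i u
  φ⊔-ι i u = cong φ⊔ (enum-unenum sizes (i , u))

  merged : Cover 𝒞‾ K 1
  merged = record
    { G       = λ _ → ⨆ (G c)
    ; inClass = λ _ → t , G c , lower ∘ inClass c , ⨆-isUnion (G c)
    ; φ       = λ _ → φ⊔ ∘ enum sizes
    ; hom     = λ _ → φ⊔-hom
    ; surj    = merged-surj
    }
    where
    merged-surj : ∀ {x y} → E K x y → ∃ λ (_ : Fin 1) → ∃₂ λ a b →
                  E (⨆ (G c)) a b × φ⊔ (enum sizes a) ≡ x × φ⊔ (enum sizes b) ≡ y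
    merged-surj e with surj c e
    ... | i , u , v , e′ , u↦x , v↦y =
      zero , ι i u , ι i v , ι-hom i e′ , trans (φ⊔-ι i u) u↦x , trans (φ⊔-ι i v) v↦y

  -- Merging only renumbers the vertices of G₁ ⊔ ⋯ ⊔ G_t.
  merged-load : ∀ x → load merged x ≡ load c x
  merged-load x = trans (ℕP.+-identityʳ _) (∑-enum sizes (λ p → ⟦ φ⊔ p ≟ x ⟧))

module Split {K t} (c : Cover 𝒞‾ K t) where
  -- Component i is the disjoint union of the co-interval graphs  parts i j,  j < count i.
  count : Fin t → ℕ
  count i = proj₁ (inClass c i)

  parts : ∀ i → Fin (count i) → Graph
  parts i = proj₁ (proj₂ (inClass c i))

  parts-co : ∀ i j → IsCoInterval (parts i j)
  parts-co i = proj₁ (proj₂ (proj₂ (inClass c i)))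

  module U (i : Fin t) = UnionOf (G c i) (parts i) (proj₂ (proj₂ (proj₂ (inClass c i))))

  part : Σᶠ count → Graph
  part p = parts (proj₁ p) (proj₂ p)

  ψ : ∀ p → Fin (n (part p)) → Fin (n K)
  ψ p = φ c (proj₁ p) ∘ U.ι (proj₁ p) (proj₂ p)

  ψ-hom : ∀ p {a b} → E (part p) a b → E K (ψ p a) (ψ p b)
  ψ-hom p = hom c (proj₁ p) ∘ U.ι-hom (proj₁ p) (proj₂ p)

  Covers : Fin (n K) → Fin (n K) → Σᶠ count → Set
  Covers x y p = ∃₂ λ a b → E (part p) a b × ψ p a ≡ x × ψ p b ≡ y

  split : Cover 𝒞 K (sum count)
  split = record
    { G       = part ∘ enum count
    ; inClass = λ k → lift (parts-co (proj₁ (enum count k)) (proj₂ (enum count k)))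
    ; φ       = ψ ∘ enum count
    ; hom     = ψ-hom ∘ enum count
    ; surj    = split-surj
    }
    where
    split-surj : ∀ {x y} → E K x y → ∃ λ k → Covers x y (enum count k)
    split-surj e with surj c e
    ... | i , u , v , e′ , u↦x , v↦y with U.ι-edge i e′
    ...   | j , a , b , e″ , a↦u , b↦v =
      unenum count (i , j) , subst (Covers _ _) (sym (enum-unenum count (i , j)))
        (a , b , e″ , trans (cong (φ c i) a↦u) u↦x , trans (cong (φ c i) b↦v) v↦y)

  -- Splitting regroups the vertices of each component by summand.
  split-load : ∀ x → load split x ≡ load c x
  split-load x = trans (∑-enum count (λ p → fiber (ψ p) x))
                       (sum-cong-≗ λ i → sym (U.∑-ι i (λ u → ⟦ φ c i u ≟ x ⟧)))

-- A fiber φᵢ⁻¹(x) is independent in Gᵢ, so its intervals pairwise meet; their common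
-- part (one-dimensional Helly) is a nonempty interval J y representing x = ψ y.  The disjointness graph of
-- these intervals maps injectively to K, still covers every edge covered by Gᵢ, and has
-- fibers of size at most those of φᵢ.
module Shrink {K t} (c : Cover 𝒞 K t) (i : Fin t) where
  private
    G₀ = G c i
    φ₀ = φ c i

  I : Fin (n G₀) → Interval
  I = proj₁ (coInterval⇒model G₀ (lower (inClass c i)))

  I-model : DisjointnessModel G₀ I
  I-model = proj₂ (coInterval⇒model G₀ (lower (inClass c i)))

  -- Intervals of one fiber meet: otherwise the fiber would contain an edge, mapped to a loop.
  fiber-meet : ∀ {x u v} → φ₀ u ≡ x → φ₀ v ≡ x → lo (I u) ℚ.≤ hi (I v)
  fiber-meet u↦x v↦x = ℚP.≮⇒≥ λ hiv<lou →
    E-irr K (subst₂ (E K) v↦x u↦x (hom c i (Equivalence.from (I-model _ _) (inj₁ (precedes hiv<lou)))))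

  image : Enumeration (λ x → ∃ λ u → φ₀ u ≡ x)
  image = enumerate (λ x → any? (λ u → φ₀ u ≟ x))

  open Enumeration image using (size; sound; complete) renaming (elem to ψ; injective to ψ-injective) public

  fiberOf : Fin size → List (Fin (n G₀))
  fiberOf y = filter (λ u → φ₀ u ≟ ψ y) (allFin (n G₀))

  latest earliest : Fin size → Fin (n G₀)
  latest   y = argmax (lo ∘ I) (proj₁ (sound y)) (fiberOf y)
  earliest y = argmin (hi ∘ I) (proj₁ (sound y)) (fiberOf y)

  -- Both lie in the fiber (the default vertex proj₁ (sound y) does, and so does every list member).
  latest-∈ : ∀ y → φ₀ (latest y) ≡ ψ y
  latest-∈ y = argmax-all (lo ∘ I) (proj₂ (sound y)) (all-filter (λ u → φ₀ u ≟ ψ y) (allFin _))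

  earliest-∈ : ∀ y → φ₀ (earliest y) ≡ ψ y
  earliest-∈ y = argmin-all (hi ∘ I) (proj₂ (sound y)) (all-filter (λ u → φ₀ u ≟ ψ y) (allFin _))

  ∈-fiberOf : ∀ {y u} → φ₀ u ≡ ψ y → u ∈ fiberOf y
  ∈-fiberOf {y} u↦y = ∈-filter⁺ (λ u → φ₀ u ≟ ψ y) (∈-allFin _) u↦y

  J : Fin size → Interval
  J y = record
    { lo    = lo (I (latest y))
    ; hi    = hi (I (earliest y))
    ; lo≤hi = fiber-meet (latest-∈ y) (earliest-∈ y)
    }

  J-⊑ : ∀ {y u} → φ₀ u ≡ ψ y → J y ⊑ I u
  J-⊑ {y} u↦y = within
    (All.lookup (f[xs]≤f[argmax] (proj₁ (sound y)) (fiberOf y)) (∈-fiberOf u↦y))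
    (All.lookup (f[argmin]≤f[xs] (proj₁ (sound y)) (fiberOf y)) (∈-fiberOf u↦y))

  shrunk : Graph
  shrunk = disjointnessGraph J

  -- If J y lies left of J y′, the fiber vertices realising the right end of J y and the left
  -- end of J y′ have disjoint intervals, hence are adjacent in G₀.
  ≺-hom : ∀ {y y′} → J y ≺ J y′ → E K (ψ y) (ψ y′)
  ≺-hom {y} {y′} (precedes gap) = subst₂ (E K) (earliest-∈ y) (latest-∈ y′)
    (hom c i (Equivalence.from (I-model _ _) (inj₁ (precedes gap))))

  shrunk-hom : ∀ {y y′} → E shrunk y y′ → E K (ψ y) (ψ y′)
  shrunk-hom (inj₁ Jy≺Jy′) = ≺-hom Jy≺Jy′
  shrunk-hom (inj₂ Jy′≺Jy) = E-sym K (≺-hom Jy′≺Jy)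

  shrunk-edge : ∀ {u v x x′} → E G₀ u v → φ₀ u ≡ x → φ₀ v ≡ x′ →
                ∃₂ λ y y′ → E shrunk y y′ × ψ y ≡ x × ψ y′ ≡ x′
  shrunk-edge {u} {v} e u↦x v↦x′ with complete (u , u↦x) | complete (v , v↦x′)
  ... | y , y↦x | y′ , y′↦x′ =
    y , y′ ,
    Disjoint-⊑ (J-⊑ (trans u↦x (sym y↦x))) (J-⊑ (trans v↦x′ (sym y′↦x′)))
               (Equivalence.to (I-model u v) e) ,
    y↦x , y′↦x′

  shrunk-fiber : ∀ x → fiber ψ x ≤ fiber φ₀ x
  shrunk-fiber = fiber-≤ ψ φ₀ ψ-injective sound

module _ {K t} (c : Cover 𝒞 K t) where
  open Shrink c

  shrink : Cover 𝒞 K t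
  shrink = record
    { G       = shrunk
    ; inClass = λ i → lift (disjointnessGraph-coInterval (J i))
    ; φ       = ψ
    ; hom     = λ i → shrunk-hom i
    ; surj    = shrink-surj
    }
    where
    shrink-surj : ∀ {x x′} → E K x x′ → ∃ λ i → ∃₂ λ y y′ → E (shrunk i) y y′ × ψ i y ≡ x × ψ i y′ ≡ x′
    shrink-surj e with surj c e
    ... | i , u , v , e′ , u↦x , v↦x′ = i , shrunk-edge i e′ u↦x v↦x′

  shrink-injective : IsInjective shrink
  shrink-injective i = ψ-injective i

  shrink-load : ∀ x → load shrink x ≤ load c x
  shrink-load x = ∑-mono-≤ λ i → shrunk-fiber i x

-- Split, then shrink: an s-local 𝒞‾-cover, injective or not, yields an s-local injective 𝒞-cover.
𝒞‾-cover⇒local𝒞 : ∀ {K t s} (c : Cover 𝒞‾ K t) → IsLocal c s → LocalCoverable 𝒞 K s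
𝒞‾-cover⇒local𝒞 c c-local =
  _ , shrink split , shrink-injective split ,
  local-≤ (shrink split) c (λ x → ℕP.≤-trans (shrink-load split x) (ℕP.≤-reflexive (split-load x))) c-local
  where open Split c

local𝒞⇔local𝒞‾ : ∀ K s → LocalCoverable 𝒞 K s ⇔ LocalCoverable 𝒞‾ K s
local𝒞⇔local𝒞‾ K s = mk⇔
  (λ (t , c , c-injective , c-local) → t , as𝒞‾ c , c-injective , c-local)
  (λ (_ , c , _ , c-local) → 𝒞‾-cover⇒local𝒞 c c-local)

local𝒞⇔folded𝒞‾ : ∀ K s → LocalCoverable 𝒞 K s ⇔ FoldedCoverable 𝒞‾ K s
local𝒞⇔folded𝒞‾ K s = mk⇔
  (λ (_ , c , _ , c-local) →
     merged c , local-≤ (merged c) c (ℕP.≤-reflexive ∘ merged-load c) c-local)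
  (λ (c , c-local) → 𝒞‾-cover⇒local𝒞 c c-local)
  where open Merge

IsMinimum-transfer : ∀ {P Q : ℕ → Set₁} → (∀ s → P s ⇔ Q s) → ∀ m → IsMinimum P m → IsMinimum Q m
IsMinimum-transfer P⇔Q (fin m) (Pm , least) =
  Equivalence.to (P⇔Q m) Pm , λ k Qk → least k (Equivalence.from (P⇔Q k) Qk)
IsMinimum-transfer P⇔Q ∞ none = λ k Qk → none k (Equivalence.from (P⇔Q k) Qk)

IsMinimum-⇔ : ∀ {P Q : ℕ → Set₁} → (∀ s → P s ⇔ Q s) → ∀ m → IsMinimum P m ⇔ IsMinimum Q m
IsMinimum-⇔ P⇔Q m = mk⇔ (IsMinimum-transfer P⇔Q m) (IsMinimum-transfer (⇔.sym ∘ P⇔Q) m)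

theorem3 : ∀ (H : Graph) (m : ℕ∞) →
    (box-ℓ H m ⇔ box‾-ℓ H m) × (box‾-ℓ H m ⇔ box‾-f H m)
theorem3 H m =
  IsMinimum-⇔ (local𝒞⇔local𝒞‾ (H ᶜ)) m ,
  IsMinimum-⇔ (λ s → ⇔.trans (⇔.sym (local𝒞⇔local𝒞‾ (H ᶜ) s)) (local𝒞⇔folded𝒞‾ (H ᶜ) s)) m
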